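{- Let $\mathbb{C}$ be a category with finite products, $\Sigma:\mathbb{C}\to\mathbb{C}$ an endofunctor with free monad $\Sigma^{*}$, $\langle T,\eta,\mu\rangle$ a monad on $\mathbb{C}$ whose Kleisli category is $\omega\mathbf{Cpo}_{\vee}$-enriched, and $\lambda:\Sigma^{*}(\mathrm{Id}\times T)\Rightarrow T\Sigma^{*}$ a GSOS law satisfying Continuity, Unitality and Observability. Then for every $\lambda$-bialgebra $(g:\Sigma X\to X,\ h:X\to TX)$, the pair $(g,h^{*})$ is a lax $\lambda$-model, i.e. $$Tg^{\#}\circ\lambda_X\circ\Sigma^{*}\langle\mathrm{id},h^{*}\rangle\ \le\ h^{*}\circ g^{\#}$$ in the ordered hom-set $\mathbb{C}(\Sigma^{*}X,TX)$.
   Context: Free monad of $\Sigma$: $\langle\Sigma^{*},\eta^{\Sigma},\mu^{\Sigma}\rangle$ with universal $\theta:\Sigma\Rightarrow\Sigma^{*}$; for $g:\Sigma X\to X$, $g^{\#}:\Sigma^{*}X\to X$ is the induced Eilenberg–Moore algebra (unique with $g^{\#}\circ\theta_X=g$). $\omega\mathbf{Cpo}_{\vee}$-enrichment of $\mathcal{K}l(T)$: each hom-set $\mathbb{C}(X,TY)$ is partially ordered by $\le$ with finite joins $\vee$; Kleisli composition $g\diamond f=\mu\circ Tg\circ f$ satisfies $i\diamond(f\vee g)=(i\diamond f)\vee(i\diamond g)$; ascending $\omega$-chains have suprema $\bigvee$; Kleisli composition is continuous in each argument w.r.t. such suprema; identities are $\eta_X$. A GSOS law is a natural transformation $\lambda:\Sigma^{*}(\mathrm{Id}\times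 T)\Rightarrow T\Sigma^{*}$ with $\lambda\circ\eta^{\Sigma}_{\mathrm{Id}\times T}=T\eta^{\Sigma}\circ\pi_2$ and $\lambda\circ\mu^{\Sigma}_{\mathrm{Id}\times T}=T\mu^{\Sigma}\circ\lambda_{\Sigma^{*}}\circ\Sigma^{*}\langle\Sigma^{*}\pi_1,\lambda\rangle$. A $\lambda$-bialgebra is a pair $(g:\Sigma X\to X, h:X\to TX)$ with $h\circ g^{\#}=Tg^{\#}\circ\lambda_X\circ\Sigma^{*}\langle\mathrm{id},h\rangle$. For $\alpha:Y\to TY$, its rt-closure is $\alpha^{*}=\bigvee_{n<\omega}(\eta_Y\vee\alpha)^{n}$ (Kleisli powers, zeroth power $\eta_Y$). The three criteria: Continuity: for every $X$ and ascending chain $f_0\le f_1\le\cdots:X\to TX$, $\lambda_X\circ\Sigma^{*}\langle\mathrm{id},\bigvee_i f_i\rangle=\bigvee_i\lambda_X\circ\Sigma^{*}\langle\mathrm{id},f_i\rangle$. Unitality: for every $f:X\to TX$, $\lambda_X\circ\Sigma^{*}\langle\mathrm{id},\eta_X\vee f\rangle\le(\lambda_X\circ\Sigma^{*}\langle\mathrm{id},f\rangle)^{*}$. Observability: for every $f:X\to TX$, $\lambda_X\circ\Sigma^{*}\langle\mathrm{id},f\diamond f\rangle\le(\lambda_X\circ\Sigma^{*}\langle\mathrm{id},f\rangle)^{*}$. -}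

module Defs where

open import Level using (Level; _⊔_) renaming (suc to lsuc)
open import Relation.Binary.PropositionalEquality
  using (_≡_; refl; sym; trans; cong; cong₂; subst)
open import Data.Nat using (ℕ; zero; suc)
open import Data.Product using (_×_; _,_; proj₁; proj₂)

IsLub : ∀ {a r} {A : Set a} → (A → A → Set r) → A → (ℕ → A) → Set (a ⊔ r)
IsLub _≤_ s f = (∀ n → f n ≤ s) × (∀ k → (∀ n → f n ≤ k) → s ≤ k)

record Category (o ℓ : Level) : Set (lsuc (o ⊔ ℓ)) where
  infixr 9 _∘_
  infix 4 _⇒_
  field
    Obj : Set o
    _⇒_ : Obj → Obj → Set ℓ
    id : ∀ {A} → A ⇒ A
    _∘_ : ∀ {A B C} → B ⇒ C → A ⇒ B → A ⇒ C
    identityˡ : ∀ {A B} {f : A ⇒ B} → id ∘ f ≡ f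
    identityʳ : ∀ {A B} {f : A ⇒ B} → f ∘ id ≡ f
    assoc : ∀ {A B C D} {f : A ⇒ B} {g : B ⇒ C} {h : C ⇒ D} →
            (h ∘ g) ∘ f ≡ h ∘ (g ∘ f)

module _ {o ℓ} (𝒞 : Category o ℓ) where
  open Category 𝒞

  record FiniteProducts : Set (o ⊔ ℓ) where
    infixr 7 _⊗_
    field
      ⊤ : Obj
      ! : ∀ {A} → A ⇒ ⊤
      !-unique : ∀ {A} (f : A ⇒ ⊤) → f ≡ !
      _⊗_ : Obj → Obj → Obj
      π₁ : ∀ {A B} → A ⊗ B ⇒ A
      π₂ : ∀ {A B} → A ⊗ B ⇒ B
      ⟨_,_⟩ : ∀ {A B C} → C ⇒ A → C ⇒ B → C ⇒ A ⊗ B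
      project₁ : ∀ {A B C} {f : C ⇒ A} {g : C ⇒ B} → π₁ ∘ ⟨ f , g ⟩ ≡ f
      project₂ : ∀ {A B C} {f : C ⇒ A} {g : C ⇒ B} → π₂ ∘ ⟨ f , g ⟩ ≡ g
      unique : ∀ {A B C} {h : C ⇒ A ⊗ B} {f : C ⇒ A} {g : C ⇒ B} →
               π₁ ∘ h ≡ f → π₂ ∘ h ≡ g → ⟨ f , g ⟩ ≡ h

  record Endofunctor : Set (o ⊔ ℓ) where
    field
      F₀ : Obj → Obj
      F₁ : ∀ {A B} → A ⇒ B → F₀ A ⇒ F₀ B
      identity : ∀ {A} → F₁ (id {A}) ≡ id
      homomorphism : ∀ {A B C} {f : A ⇒ B} {g : B ⇒ C} →
                     F₁ (g ∘ f) ≡ F₁ g ∘ F₁ f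

  record NatTrans (F G : Endofunctor) : Set (o ⊔ ℓ) where
    private
      module F = Endofunctor F
      module G = Endofunctor G
    field
      η : ∀ X → F.F₀ X ⇒ G.F₀ X
      commute : ∀ {X Y} (f : X ⇒ Y) → η Y ∘ F.F₁ f ≡ G.F₁ f ∘ η X

  _∘F_ : Endofunctor → Endofunctor → Endofunctor
  F ∘F G = record
    { F₀ = λ X → F.F₀ (G.F₀ X)
    ; F₁ = λ f → F.F₁ (G.F₁ f)
    ; identity = trans (cong F.F₁ G.identity) F.identity
    ; homomorphism = trans (cong F.F₁ G.homomorphism) F.homomorphism
    }
    where
      module F = Endofunctor F
      module G = Endofunctor G

  record Monad : Set (o ⊔ ℓ) where
    field
      F : Endofunctor
    open Endofunctor F public
    field
      η : ∀ X → X ⇒ F₀ X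
      μ : ∀ X → F₀ (F₀ X) ⇒ F₀ X
      η-natural : ∀ {X Y} (f : X ⇒ Y) → η Y ∘ f ≡ F₁ f ∘ η X
      μ-natural : ∀ {X Y} (f : X ⇒ Y) → μ Y ∘ F₁ (F₁ f) ≡ F₁ f ∘ μ X
      unitˡ : ∀ {X} → μ X ∘ F₁ (η X) ≡ id
      unitʳ : ∀ {X} → μ X ∘ η (F₀ X) ≡ id
      mult-assoc : ∀ {X} → μ X ∘ F₁ (μ X) ≡ μ X ∘ μ (F₀ X)

  -- Free monad Σ* of Σ with universal θ : Σ ⇒ Σ*; every Σ-algebra g
  -- induces a unique Eilenberg–Moore algebra g# with g# ∘ θ_X = g.
  record FreeMonad (Sig : Endofunctor) : Set (o ⊔ ℓ) where
    private module Sig = Endofunctor Sig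
    field
      monad : Monad
    open Monad monad
    field
      θ : NatTrans Sig F
      sharp : ∀ {X} → Sig.F₀ X ⇒ X → F₀ X ⇒ X
      sharp-unit : ∀ {X} (g : Sig.F₀ X ⇒ X) → sharp g ∘ η X ≡ id
      sharp-mult : ∀ {X} (g : Sig.F₀ X ⇒ X) →
                   sharp g ∘ μ X ≡ sharp g ∘ F₁ (sharp g)
      sharp-θ : ∀ {X} (g : Sig.F₀ X ⇒ X) → sharp g ∘ NatTrans.η θ X ≡ g
      sharp-unique : ∀ {X} (g : Sig.F₀ X ⇒ X) (a : F₀ X ⇒ X) →
                     a ∘ η X ≡ id → a ∘ μ X ≡ a ∘ F₁ a →
                     a ∘ NatTrans.η θ X ≡ g → a ≡ sharp g

  IdTimes : FiniteProducts → Monad → Endofunctor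
  IdTimes P T = record
    { F₀ = λ X → X ⊗ T₀ X
    ; F₁ = λ f → ⟨ f ∘ π₁ , T₁ f ∘ π₂ ⟩
    ; identity = unique (trans identityʳ (sym identityˡ))
                        (trans identityʳ (trans (sym identityˡ)
                          (cong (_∘ π₂) (sym T.identity))))
    ; homomorphism = λ {_} {_} {_} {f} {g} → unique
        (trans (sym assoc) (trans (cong (_∘ ⟨ f ∘ π₁ , T₁ f ∘ π₂ ⟩) project₁)
          (trans assoc (trans (cong (g ∘_) project₁) (sym assoc)))))
        (trans (sym assoc) (trans (cong (_∘ ⟨ f ∘ π₁ , T₁ f ∘ π₂ ⟩) project₂)
          (trans assoc (trans (cong (T₁ g ∘_) project₂)
            (trans (sym assoc) (cong (_∘ π₂) (sym T.homomorphism)))))))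
    }
    where
      open FiniteProducts P
      module T = Monad T
      T₀ = T.F₀
      T₁ : ∀ {A B} → A ⇒ B → T₀ A ⇒ T₀ B
      T₁ = T.F₁

  module _ (T : Monad) where
    open Monad T renaming (F₀ to T₀; F₁ to T₁)

    infixr 9 _◇_
    _◇_ : ∀ {X Y Z} → Y ⇒ T₀ Z → X ⇒ T₀ Y → X ⇒ T₀ Z
    g ◇ f = μ _ ∘ (T₁ g ∘ f)

    record KleisliEnrichment (r : Level) : Set (o ⊔ ℓ ⊔ lsuc r) where
      infix 4 _≤_
      infixr 6 _∨_
      field
        _≤_ : ∀ {X Y} → X ⇒ T₀ Y → X ⇒ T₀ Y → Set r
        ≤-refl : ∀ {X Y} {f : X ⇒ T₀ Y} → f ≤ f
        ≤-trans : ∀ {X Y} {f g k : X ⇒ T₀ Y} → f ≤ g → g ≤ k → f ≤ k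
        ≤-antisym : ∀ {X Y} {f g : X ⇒ T₀ Y} → f ≤ g → g ≤ f → f ≡ g
        ⊥ : ∀ {X Y} → X ⇒ T₀ Y
        ⊥-least : ∀ {X Y} (f : X ⇒ T₀ Y) → ⊥ ≤ f
        _∨_ : ∀ {X Y} → X ⇒ T₀ Y → X ⇒ T₀ Y → X ⇒ T₀ Y
        ∨-ub₁ : ∀ {X Y} (f g : X ⇒ T₀ Y) → f ≤ f ∨ g
        ∨-ub₂ : ∀ {X Y} (f g : X ⇒ T₀ Y) → g ≤ f ∨ g
        ∨-least : ∀ {X Y} {f g k : X ⇒ T₀ Y} → f ≤ k → g ≤ k → f ∨ g ≤ k
        ◇-distrib-∨ : ∀ {X Y Z} (i : Y ⇒ T₀ Z) (f g : X ⇒ T₀ Y) →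
                      i ◇ (f ∨ g) ≡ (i ◇ f) ∨ (i ◇ g)
        ⋁ : ∀ {X Y} (f : ℕ → X ⇒ T₀ Y) → (∀ n → f n ≤ f (suc n)) → X ⇒ T₀ Y
        ⋁-lub : ∀ {X Y} (f : ℕ → X ⇒ T₀ Y) (c : ∀ n → f n ≤ f (suc n)) →
                IsLub _≤_ (⋁ f c) f
        ◇-contˡ : ∀ {X Y Z} (f : ℕ → Y ⇒ T₀ Z) (c : ∀ n → f n ≤ f (suc n))
                  (g : X ⇒ T₀ Y) →
                  IsLub _≤_ (⋁ f c ◇ g) (λ n → f n ◇ g)
        ◇-contʳ : ∀ {X Y Z} (g : Y ⇒ T₀ Z) (f : ℕ → X ⇒ T₀ Y)
                  (c : ∀ n → f n ≤ f (suc n)) →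
                  IsLub _≤_ (g ◇ ⋁ f c) (λ n → g ◇ f n)

    module _ {r} (E : KleisliEnrichment r) where
      open KleisliEnrichment E

      ◇-monoˡ : ∀ {X Y Z} {f f' : Y ⇒ T₀ Z} → f ≤ f' → (g : X ⇒ T₀ Y) →
                f ◇ g ≤ f' ◇ g
      ◇-monoˡ {f = f} {f'} p g =
        subst (λ s → f ◇ g ≤ s ◇ g) sup≡ (proj₁ (◇-contˡ c cc g) 0)
        where
          c : ℕ → _
          c zero = f
          c (suc _) = f'
          cc : ∀ n → c n ≤ c (suc n)
          cc zero = p
          cc (suc n) = ≤-refl
          bound : ∀ n → c n ≤ f'
          bound zero = p
          bound (suc n) = ≤-refl
          sup≡ : ⋁ c cc ≡ f'
          sup≡ = ≤-antisym (proj₂ (⋁-lub c cc) f' bound) (proj₁ (⋁-lub c cc) 1)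

      ηˡ-◇ : ∀ {X Y} (p : X ⇒ T₀ Y) → η Y ◇ p ≡ p
      ηˡ-◇ p = trans (sym assoc) (trans (cong (_∘ p) unitˡ) identityˡ)

      rtPow : ∀ {Y} → Y ⇒ T₀ Y → ℕ → Y ⇒ T₀ Y
      rtPow {Y} α zero = η Y
      rtPow {Y} α (suc n) = (η Y ∨ α) ◇ rtPow α n

      rtPow-chain : ∀ {Y} (α : Y ⇒ T₀ Y) (n : ℕ) → rtPow α n ≤ rtPow α (suc n)
      rtPow-chain {Y} α n =
        subst (_≤ rtPow α (suc n)) (ηˡ-◇ (rtPow α n))
              (◇-monoˡ (∨-ub₁ (η Y) α) (rtPow α n))

      rtClosure : ∀ {Y} → Y ⇒ T₀ Y → Y ⇒ T₀ Y
      rtClosure α = ⋁ (rtPow α) (rtPow-chain α)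

  module _ (P : FiniteProducts) (Sig : Endofunctor) (S : FreeMonad Sig)
           (T : Monad) where
    open FiniteProducts P
    private
      module Sig = Endofunctor Sig
      module S = FreeMonad S
      module Σ* = Monad S.monad
      module T = Monad T

    record GSOSLaw : Set (o ⊔ ℓ) where
      field
        law : NatTrans (Σ*.F ∘F IdTimes P T) (T.F ∘F Σ*.F)
      lam : ∀ X → Σ*.F₀ (X ⊗ T.F₀ X) ⇒ T.F₀ (Σ*.F₀ X)
      lam = NatTrans.η law
      field
        law-unit : ∀ X → lam X ∘ Σ*.η (X ⊗ T.F₀ X) ≡ T.F₁ (Σ*.η X) ∘ π₂
        law-mult : ∀ X → lam X ∘ Σ*.μ (X ⊗ T.F₀ X) ≡
                   T.F₁ (Σ*.μ X) ∘ (lam (Σ*.F₀ X) ∘ Σ*.F₁ ⟨ Σ*.F₁ π₁ , lam X ⟩)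

    module _ (Λ : GSOSLaw) where
      open GSOSLaw Λ

      lift : ∀ {X} → X ⇒ T.F₀ X → Σ*.F₀ X ⇒ T.F₀ (Σ*.F₀ X)
      lift {X} f = lam X ∘ Σ*.F₁ ⟨ id , f ⟩

      IsBialgebra : ∀ {X} → Sig.F₀ X ⇒ X → X ⇒ T.F₀ X → Set ℓ
      IsBialgebra g h = h ∘ S.sharp g ≡ T.F₁ (S.sharp g) ∘ lift h

      module _ {r} (E : KleisliEnrichment T r) where
        open KleisliEnrichment E

        Continuity : Set (o ⊔ ℓ ⊔ r)
        Continuity = ∀ X (f : ℕ → X ⇒ T.F₀ X) (c : ∀ n → f n ≤ f (suc n)) →
                     IsLub _≤_ (lift (⋁ f c)) (λ n → lift (f n))

        Unitality : Set (o ⊔ ℓ ⊔ r)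
        Unitality = ∀ X (f : X ⇒ T.F₀ X) →
                    lift (T.η X ∨ f) ≤ rtClosure T E (lift f)

        Observability : Set (o ⊔ ℓ ⊔ r)
        Observability = ∀ X (f : X ⇒ T.F₀ X) →
                        lift (_◇_ T f f) ≤ rtClosure T E (lift f)

        IsLaxModel : ∀ {X} → Sig.F₀ X ⇒ X → X ⇒ T.F₀ X → Set r
        IsLaxModel g k = T.F₁ (S.sharp g) ∘ lift k ≤ k ∘ S.sharp g

-- The bialgebra equation says that the Kleisli arrow η ∘ g# is a simulation from
-- λ ∘ Σ*⟨id, h⟩ to h, and simulations lift to reflexive-transitive closures. It
-- therefore suffices to show λ ∘ Σ*⟨id, h*⟩ ≤ (λ ∘ Σ*⟨id, h⟩)*, and by Continuity
-- it is enough to bound λ ∘ Σ*⟨id, (η ∨ h)ⁿ⟩ for each n. The first power is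
-- Unitality; Observability at f = (η ∨ h)ⁿ, together with idempotence of the
-- closure, bounds the power 2n once the power n is bounded, and monotonicity in n
-- fills in the powers between.
module Submission where

open import Level using (Level)
open import Defs hiding (_◇_; ◇-monoˡ; ηˡ-◇; rtPow; rtPow-chain; lift)
open import Data.Nat using (ℕ; zero; suc; _+_; _≤′_; ≤′-refl; ≤′-step; s≤s)
  renaming (_≤_ to _≤ℕ_)
open import Data.Nat.Properties using (≤⇒≤′; m≤n+m)
open import Data.Product using (proj₁; proj₂)
open import Relation.Binary.Bundles using (Poset)
open import Relation.Binary.PropositionalEquality
  using (_≡_; refl; sym; trans; cong; subst; isEquivalence; module ≡-Reasoning)
import Relation.Binary.Reasoning.PartialOrder as PosetReasoning

module Kleisli {o ℓ} {𝒞 : Category o ℓ} (T : Monad 𝒞) where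
  open Category 𝒞
  open Monad T renaming (F₀ to T₀; F₁ to T₁)

  infixr 9 _◇_
  _◇_ : ∀ {X Y Z} → Y ⇒ T₀ Z → X ⇒ T₀ Y → X ⇒ T₀ Z
  _◇_ = Defs._◇_ 𝒞 T

  ◇-identityˡ : ∀ {X Y} (f : X ⇒ T₀ Y) → η Y ◇ f ≡ f
  ◇-identityˡ f = begin
    μ _ ∘ (T₁ (η _) ∘ f) ≡⟨ sym assoc ⟩
    (μ _ ∘ T₁ (η _)) ∘ f ≡⟨ cong (_∘ f) unitˡ ⟩
    id ∘ f               ≡⟨ identityˡ ⟩
    f                    ∎
    where open ≡-Reasoning

  ◇-identityʳ : ∀ {X Y} (f : X ⇒ T₀ Y) → f ◇ η X ≡ f
  ◇-identityʳ f = begin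
    μ _ ∘ (T₁ f ∘ η _) ≡⟨ cong (μ _ ∘_) (η-natural f) ⟨
    μ _ ∘ (η _ ∘ f)    ≡⟨ sym assoc ⟩
    (μ _ ∘ η _) ∘ f    ≡⟨ cong (_∘ f) unitʳ ⟩
    id ∘ f             ≡⟨ identityˡ ⟩
    f                  ∎
    where open ≡-Reasoning

  ◇-assoc : ∀ {W X Y Z} (a : Y ⇒ T₀ Z) (b : X ⇒ T₀ Y) (c : W ⇒ T₀ X) →
            (a ◇ b) ◇ c ≡ a ◇ (b ◇ c)
  ◇-assoc a b c = begin
    μ _ ∘ (T₁ (μ _ ∘ (T₁ a ∘ b)) ∘ c)
      ≡⟨ cong (λ t → μ _ ∘ (t ∘ c)) (trans homomorphism (cong (T₁ (μ _) ∘_) homomorphism)) ⟩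
    μ _ ∘ ((T₁ (μ _) ∘ (T₁ (T₁ a) ∘ T₁ b)) ∘ c)
      ≡⟨ trans (cong (μ _ ∘_) assoc) (sym assoc) ⟩
    (μ _ ∘ T₁ (μ _)) ∘ ((T₁ (T₁ a) ∘ T₁ b) ∘ c)
      ≡⟨ cong (_∘ ((T₁ (T₁ a) ∘ T₁ b) ∘ c)) mult-assoc ⟩
    (μ _ ∘ μ _) ∘ ((T₁ (T₁ a) ∘ T₁ b) ∘ c)
      ≡⟨ trans assoc (cong (μ _ ∘_) (trans (cong (μ _ ∘_) assoc) (sym assoc))) ⟩
    μ _ ∘ ((μ _ ∘ T₁ (T₁ a)) ∘ (T₁ b ∘ c))
      ≡⟨ cong (λ t → μ _ ∘ (t ∘ (T₁ b ∘ c))) (μ-natural a) ⟩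
    μ _ ∘ ((T₁ a ∘ μ _) ∘ (T₁ b ∘ c))
      ≡⟨ cong (μ _ ∘_) assoc ⟩
    μ _ ∘ (T₁ a ∘ (μ _ ∘ (T₁ b ∘ c)))
      ∎
    where open ≡-Reasoning

  ◇-pureˡ : ∀ {X Y Z} (m : Y ⇒ Z) (f : X ⇒ T₀ Y) → (η Z ∘ m) ◇ f ≡ T₁ m ∘ f
  ◇-pureˡ m f = begin
    μ _ ∘ (T₁ (η _ ∘ m) ∘ f)       ≡⟨ cong (λ t → μ _ ∘ (t ∘ f)) homomorphism ⟩
    μ _ ∘ ((T₁ (η _) ∘ T₁ m) ∘ f)  ≡⟨ cong (μ _ ∘_) assoc ⟩
    η _ ◇ (T₁ m ∘ f)               ≡⟨ ◇-identityˡ (T₁ m ∘ f) ⟩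
    T₁ m ∘ f                       ∎
    where open ≡-Reasoning

  ◇-pureʳ : ∀ {X Y Z} (k : Y ⇒ T₀ Z) (m : X ⇒ Y) → k ◇ (η Y ∘ m) ≡ k ∘ m
  ◇-pureʳ k m = begin
    μ _ ∘ (T₁ k ∘ (η _ ∘ m))  ≡⟨ trans (cong (μ _ ∘_) (sym assoc)) (sym assoc) ⟩
    (k ◇ η _) ∘ m             ≡⟨ cong (_∘ m) (◇-identityʳ k) ⟩
    k ∘ m                     ∎
    where open ≡-Reasoning

  module Enriched {r} (E : KleisliEnrichment 𝒞 T r) where
    open KleisliEnrichment E

    homPoset : Obj → Obj → Poset ℓ ℓ r
    homPoset X Y = record
      { Carrier = X ⇒ T₀ Y
      ; _≈_ = _≡_
      ; _≤_ = _≤_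
      ; isPartialOrder = record
        { isPreorder = record
          { isEquivalence = isEquivalence
          ; reflexive = λ { refl → ≤-refl }
          ; trans = ≤-trans
          }
        ; antisym = ≤-antisym
        }
      }

    module ≤-Reasoning {X Y : Obj} = PosetReasoning (homPoset X Y)

    ≡⇒≤ : ∀ {X Y} {f g : X ⇒ T₀ Y} → f ≡ g → f ≤ g
    ≡⇒≤ refl = ≤-refl

    lub-upper : ∀ {X Y} {s : X ⇒ T₀ Y} {f : ℕ → X ⇒ T₀ Y} →
                IsLub _≤_ s f → ∀ n → f n ≤ s
    lub-upper = proj₁

    lub-least : ∀ {X Y} {s k : X ⇒ T₀ Y} {f : ℕ → X ⇒ T₀ Y} →
                IsLub _≤_ s f → (∀ n → f n ≤ k) → s ≤ k
    lub-least l = proj₂ l _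

    -- Apply continuity to the chain f ≤ f' ≤ f' ≤ ⋯, whose supremum is f'.
    continuous⇒monotone :
      ∀ {X Y Z W} (F : X ⇒ T₀ Y → Z ⇒ T₀ W) →
      (∀ (f : ℕ → X ⇒ T₀ Y) (c : ∀ n → f n ≤ f (suc n)) →
         IsLub _≤_ (F (⋁ f c)) (λ n → F (f n))) →
      ∀ {f f'} → f ≤ f' → F f ≤ F f'
    continuous⇒monotone F F-cont {f} {f'} f≤f' =
      subst (λ s → F f ≤ F s) ⋁-jump (lub-upper (F-cont jump jump-chain) 0)
      where
        jump : ℕ → _
        jump zero = f
        jump (suc _) = f'
        jump-chain : ∀ n → jump n ≤ jump (suc n)
        jump-chain zero = f≤f'
        jump-chain (suc _) = ≤-refl
        jump≤f' : ∀ n → jump n ≤ f'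
        jump≤f' zero = f≤f'
        jump≤f' (suc _) = ≤-refl
        ⋁-jump : ⋁ jump jump-chain ≡ f'
        ⋁-jump = ≤-antisym (lub-least (⋁-lub jump jump-chain) jump≤f')
                           (lub-upper (⋁-lub jump jump-chain) 1)

    ◇-monoˡ : ∀ {X Y Z} {f f' : Y ⇒ T₀ Z} → f ≤ f' → (g : X ⇒ T₀ Y) → f ◇ g ≤ f' ◇ g
    ◇-monoˡ = Defs.◇-monoˡ 𝒞 T E

    ◇-monoʳ : ∀ {X Y Z} (i : Y ⇒ T₀ Z) {f g : X ⇒ T₀ Y} → f ≤ g → i ◇ f ≤ i ◇ g
    ◇-monoʳ i = continuous⇒monotone (i ◇_) (◇-contʳ i)

    chain-mono : ∀ {X Y} (f : ℕ → X ⇒ T₀ Y) → (∀ n → f n ≤ f (suc n)) →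
                 ∀ {m n} → m ≤′ n → f m ≤ f n
    chain-mono f c ≤′-refl = ≤-refl
    chain-mono f c (≤′-step m≤′n) = ≤-trans (chain-mono f c m≤′n) (c _)

    rtPow : ∀ {Y} → Y ⇒ T₀ Y → ℕ → Y ⇒ T₀ Y
    rtPow = Defs.rtPow 𝒞 T E

    infix 10 _⋆
    _⋆ : ∀ {Y} → Y ⇒ T₀ Y → Y ⇒ T₀ Y
    α ⋆ = rtClosure 𝒞 T E α

    rtPow-chain : ∀ {Y} (α : Y ⇒ T₀ Y) n → rtPow α n ≤ rtPow α (suc n)
    rtPow-chain = Defs.rtPow-chain 𝒞 T E

    rtPow-+ : ∀ {Y} (α : Y ⇒ T₀ Y) m n → rtPow α (m + n) ≡ rtPow α m ◇ rtPow α n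
    rtPow-+ α zero n = sym (◇-identityˡ (rtPow α n))
    rtPow-+ α (suc m) n =
      trans (cong (_ ◇_) (rtPow-+ α m n)) (sym (◇-assoc _ (rtPow α m) (rtPow α n)))

    rtPow-mono : ∀ {Y} (α : Y ⇒ T₀ Y) {m n} → m ≤ℕ n → rtPow α m ≤ rtPow α n
    rtPow-mono α m≤n = chain-mono (rtPow α) (rtPow-chain α) (≤⇒≤′ m≤n)

    rtPow≤rtClosure : ∀ {Y} (α : Y ⇒ T₀ Y) n → rtPow α n ≤ α ⋆
    rtPow≤rtClosure α = lub-upper (⋁-lub (rtPow α) (rtPow-chain α))

    rtClosure-◇-idem : ∀ {Y} (α : Y ⇒ T₀ Y) → α ⋆ ◇ α ⋆ ≤ α ⋆
    rtClosure-◇-idem α =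
      lub-least (◇-contˡ (rtPow α) (rtPow-chain α) (α ⋆)) λ m →
      lub-least (◇-contʳ (rtPow α m) (rtPow α) (rtPow-chain α)) λ n →
      subst (_≤ α ⋆) (rtPow-+ α m n) (rtPow≤rtClosure α (m + n))

    rtClosure-least : ∀ {Y} {α β : Y ⇒ T₀ Y} → β ≤ α ⋆ → β ⋆ ≤ α ⋆
    rtClosure-least {Y} {α} {β} β≤α⋆ =
      lub-least (⋁-lub (rtPow β) (rtPow-chain β)) rtPow-β≤α⋆
      where
        open ≤-Reasoning
        rtPow-β≤α⋆ : ∀ n → rtPow β n ≤ α ⋆
        rtPow-β≤α⋆ zero = rtPow≤rtClosure α 0
        rtPow-β≤α⋆ (suc n) = begin
          (η Y ∨ β) ◇ rtPow β n
            ≤⟨ ◇-monoˡ (∨-least (rtPow≤rtClosure α 0) β≤α⋆) (rtPow β n) ⟩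
          α ⋆ ◇ rtPow β n     ≤⟨ ◇-monoʳ (α ⋆) (rtPow-β≤α⋆ n) ⟩
          α ⋆ ◇ α ⋆           ≤⟨ rtClosure-◇-idem α ⟩
          α ⋆                 ∎

    rtClosure-simulation : ∀ {X Y} (a : X ⇒ T₀ Y) {α : X ⇒ T₀ X} {β : Y ⇒ T₀ Y} →
                           a ◇ α ≤ β ◇ a → a ◇ α ⋆ ≤ β ⋆ ◇ a
    rtClosure-simulation {X} {Y} a {α} {β} a◇α≤β◇a =
      lub-least (◇-contʳ a (rtPow α) (rtPow-chain α)) λ n →
        ≤-trans (simulate-rtPow n) (◇-monoˡ (rtPow≤rtClosure β n) a)
      where
        open ≤-Reasoning
        simulate-step : a ◇ (η X ∨ α) ≤ (η Y ∨ β) ◇ a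
        simulate-step = begin
          a ◇ (η X ∨ α)             ≡⟨ ◇-distrib-∨ a (η X) α ⟩
          (a ◇ η X) ∨ (a ◇ α)
            ≡⟨ cong (_∨ (a ◇ α)) (trans (◇-identityʳ a) (sym (◇-identityˡ a))) ⟩
          (η Y ◇ a) ∨ (a ◇ α)
            ≤⟨ ∨-least (◇-monoˡ (∨-ub₁ (η Y) β) a)
                       (≤-trans a◇α≤β◇a (◇-monoˡ (∨-ub₂ (η Y) β) a)) ⟩
          (η Y ∨ β) ◇ a             ∎
        simulate-rtPow : ∀ n → a ◇ rtPow α n ≤ rtPow β n ◇ a
        simulate-rtPow zero =
          ≡⇒≤ (trans (◇-identityʳ a) (sym (◇-identityˡ a)))
        simulate-rtPow (suc n) = begin
          a ◇ (η X ∨ α) ◇ rtPow α n   ≡⟨ ◇-assoc a (η X ∨ α) (rtPow α n) ⟨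
          (a ◇ (η X ∨ α)) ◇ rtPow α n ≤⟨ ◇-monoˡ simulate-step (rtPow α n) ⟩
          ((η Y ∨ β) ◇ a) ◇ rtPow α n ≡⟨ ◇-assoc (η Y ∨ β) a (rtPow α n) ⟩
          (η Y ∨ β) ◇ a ◇ rtPow α n   ≤⟨ ◇-monoʳ (η Y ∨ β) (simulate-rtPow n) ⟩
          (η Y ∨ β) ◇ rtPow β n ◇ a   ≡⟨ ◇-assoc (η Y ∨ β) (rtPow β n) a ⟨
          ((η Y ∨ β) ◇ rtPow β n) ◇ a ∎

    module GSOS {P : FiniteProducts 𝒞} {Sig : Endofunctor 𝒞} {S : FreeMonad 𝒞 Sig}
             (Λ : GSOSLaw 𝒞 P Sig S T) where
      private
        module Σ* = Monad (FreeMonad.monad S)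

      lift : ∀ {X} → X ⇒ T₀ X → Σ*.F₀ X ⇒ T₀ (Σ*.F₀ X)
      lift = Defs.lift 𝒞 P Sig S T Λ

      lift-mono : Continuity 𝒞 P Sig S T Λ E →
                  ∀ {X} {f f' : X ⇒ T₀ X} → f ≤ f' → lift f ≤ lift f'
      lift-mono cont {X} = continuous⇒monotone lift (cont X)

      lift-rtPow≤ : Continuity 𝒞 P Sig S T Λ E → Unitality 𝒞 P Sig S T Λ E →
                    Observability 𝒞 P Sig S T Λ E →
                    ∀ {X} (h : X ⇒ T₀ X) n → lift (rtPow h n) ≤ lift h ⋆
      lift-rtPow≤ cont unit obs {X} h = bound
        where
          open ≤-Reasoning
          bound : ∀ n → lift (rtPow h n) ≤ lift h ⋆
          bound zero = ≤-trans (lift-mono cont (rtPow-chain h 0)) (bound 1)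
          bound (suc zero) =
            subst (λ f → lift f ≤ lift h ⋆) (sym (◇-identityʳ (η X ∨ h))) (unit X h)
          bound (suc (suc n)) = begin
            lift (rtPow h (2 + n))
              ≤⟨ lift-mono cont (rtPow-mono h (s≤s (m≤n+m (suc n) n))) ⟩
            lift (rtPow h (suc n + suc n))
              ≡⟨ cong lift (rtPow-+ h (suc n) (suc n)) ⟩
            lift (rtPow h (suc n) ◇ rtPow h (suc n))
              ≤⟨ obs X (rtPow h (suc n)) ⟩
            lift (rtPow h (suc n)) ⋆
              ≤⟨ rtClosure-least (bound (suc n)) ⟩
            lift h ⋆ ∎

      lift-rtClosure≤ : Continuity 𝒞 P Sig S T Λ E → Unitality 𝒞 P Sig S T Λ E →
                        Observability 𝒞 P Sig S T Λ E →
                        ∀ {X} (h : X ⇒ T₀ X) → lift (h ⋆) ≤ lift h ⋆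
      lift-rtClosure≤ cont unit obs {X} h =
        lub-least (cont X (rtPow h) (rtPow-chain h)) (lift-rtPow≤ cont unit obs h)

      bialgebra⇒simulation :
        ∀ {X} {g : Endofunctor.F₀ Sig X ⇒ X} {h : X ⇒ T₀ X} →
        IsBialgebra 𝒞 P Sig S T Λ g h →
        let ĝ = FreeMonad.sharp S g in
        (η X ∘ ĝ) ◇ lift h ≡ h ◇ (η X ∘ ĝ)
      bialgebra⇒simulation {X} {g} {h} bialg = begin
        (η X ∘ ĝ) ◇ lift h ≡⟨ ◇-pureˡ ĝ (lift h) ⟩
        T₁ ĝ ∘ lift h      ≡⟨ bialg ⟨
        h ∘ ĝ              ≡⟨ ◇-pureʳ h ĝ ⟨
        h ◇ (η X ∘ ĝ)      ∎
        where
          open ≡-Reasoning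
          ĝ = FreeMonad.sharp S g

mainTheorem5 : ∀ {o ℓ r : Level} (𝒞 : Category o ℓ) (P : FiniteProducts 𝒞)
    (Sig : Endofunctor 𝒞) (S : FreeMonad 𝒞 Sig) (T : Monad 𝒞)
    (E : KleisliEnrichment 𝒞 T r) (Λ : GSOSLaw 𝒞 P Sig S T) →
    Continuity 𝒞 P Sig S T Λ E →
    Unitality 𝒞 P Sig S T Λ E →
    Observability 𝒞 P Sig S T Λ E →
    (X : Category.Obj 𝒞)
    (g : Category._⇒_ 𝒞 (Endofunctor.F₀ Sig X) X)
    (h : Category._⇒_ 𝒞 X (Monad.F₀ T X)) →
    IsBialgebra 𝒞 P Sig S T Λ g h →
    IsLaxModel 𝒞 P Sig S T Λ E g (rtClosure 𝒞 T E h)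
mainTheorem5 𝒞 P Sig S T E Λ cont unit obs X g h bialg = begin
  T₁ ĝ ∘ lift (h ⋆)         ≡⟨ ◇-pureˡ ĝ (lift (h ⋆)) ⟨
  (η X ∘ ĝ) ◇ lift (h ⋆)    ≤⟨ ◇-monoʳ (η X ∘ ĝ) (lift-rtClosure≤ cont unit obs h) ⟩
  (η X ∘ ĝ) ◇ lift h ⋆
    ≤⟨ rtClosure-simulation (η X ∘ ĝ) (≡⇒≤ (bialgebra⇒simulation bialg)) ⟩
  h ⋆ ◇ (η X ∘ ĝ)           ≡⟨ ◇-pureʳ (h ⋆) ĝ ⟩
  h ⋆ ∘ ĝ                   ∎
  where
    open Category 𝒞
    open Monad T using (η) renaming (F₁ to T₁)
    open Kleisli T
    open Enriched E
    open GSOS Λ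
    open ≤-Reasoning
    ĝ = FreeMonad.sharp S g
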